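{- Let $N=\prod_{i=1}^n p_i$ be square-free, let $\mathcal{S}=\{d_1<d_2<\dots<d_s\}$ ($s=2^n$) be the set of positive divisors of $N$ listed in the total order described in the context, and write $d_{ij}:=d_i\boxplus d_j$. Then: (1) $d_{ij}=d_{ji}=d_{s+1-i}\boxplus d_{s+1-j}$; (2) $d_{i1}=N/d_i=d_{s+1-i}$; (3) for any $d=d_i$, $\mathcal{S}=\{d\boxplus d_1,\ d\boxplus d_2,\dots, d\boxplus d_s\}$; (4) $\mathrm{sgn}(d_{ij})=\mathrm{sgn}(d_i)\,\mathrm{sgn}(d_j)$; (5) if $i\neq j$ and $p_n\nmid d_{ij}$, then for every $k$ with $p_n\nmid d_{kj}$ we have $d_{ik}\cdot d_{kj}=d_{i\,r(k)}\cdot d_{r(k)\,j}$, where $r(k)$ is the unique index in $\{1,\dots,s\}$ with $d_{r(k)\,j}=p_n\cdot d_{kj}$.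
   Context: Each divisor $a$ of $N=\prod_{i=1}^n p_i$ is identified with the vector $(a_1,\dots,a_n)\in\{0,1\}^n$, where $a_i=1$ iff $p_i\mid a$. Total order on $\mathcal{S}$: for $a\neq b$, if $\omega(a)<\omega(b)$ then $a<b$ ($\omega$ = number of distinct prime factors); if $\omega(a)=\omega(b)$, then $a<b$ iff for the first index $t$ with $a_t\neq b_t$ one has $a_t>b_t$. Box addition: $a\boxplus b=(c_1,\dots,c_n)$ with $c_i\in\{0,1\}$, $c_i\equiv a_i+b_i+1\pmod 2$. Sign: $\mathrm{sgn}(a)=(-1)^{\omega(N)-\omega(a)}$. -}

module Defs where

open import Data.Bool using (Bool; true; false; not; _xor_)
open import Data.Nat using (ℕ; zero; suc; _*_; _<_; _∸_)
import Data.Nat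
import Data.Fin
open Data.Fin using (Fin)
open import Data.Nat.DivMod using (_/_)
open import Data.Vec using (Vec; []; _∷_; zipWith; foldr)
open import Data.Integer using (ℤ; -1ℤ; _^_)
open import Data.Product using (_×_)
open import Data.Sum using (_⊎_)
open import Relation.Binary.PropositionalEquality using (_≡_)

-- A divisor a of N = p₁⋯pₙ is identified with its exponent vector (a₁,…,aₙ) ∈ {0,1}ⁿ
-- (true = 1, false = 0).
Div : ℕ → Set
Div n = Vec Bool n

ω : ∀ {n} → Div n → ℕ
ω []          = 0
ω (true  ∷ a) = suc (ω a)
ω (false ∷ a) = ω a

data _≺lex_ : ∀ {n} → Div n → Div n → Set where
  here  : ∀ {n} {a b : Div n} → (true ∷ a) ≺lex (false ∷ b)
  there : ∀ {n} {x} {a b : Div n} → a ≺lex b → (x ∷ a) ≺lex (x ∷ b)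

_<S_ : ∀ {n} → Div n → Div n → Set
a <S b = (ω a < ω b) ⊎ ((ω a ≡ ω b) × (a ≺lex b))

-- Box addition: c_i ≡ a_i + b_i + 1 (mod 2).
_⊞_ : ∀ {n} → Div n → Div n → Div n
a ⊞ b = zipWith (λ x y → not (x xor y)) a b

val : ∀ {n} → Vec ℕ n → Div n → ℕ
val []       []          = 1
val (q ∷ ps) (true  ∷ a) = q * val ps a
val (q ∷ ps) (false ∷ a) = val ps a

prodN : ∀ {n} → Vec ℕ n → ℕ
prodN = foldr _ _*_ 1

-- Total natural division (m ÷ 0 := 0); only used with positive divisors.
_div_ : ℕ → ℕ → ℕ
m div zero    = 0
m div (suc k) = m / suc k

-- sgn(a) = (-1)^(ω(N) - ω(a)), with ω(N) = n.
sgn : ∀ {n} → Div n → ℤ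
sgn {n} a = -1ℤ ^ (n ∸ ω a)

-- The first index of Fin (2 ^ n) (paper's index 1); toℕ (first n) = 0.
first : (n : ℕ) → Fin (2 Data.Nat.^ n)
first zero    = Data.Fin.zero
first (suc n) = first n Data.Fin.↑ˡ _

{-# OPTIONS --safe #-}
-- Box addition is bitwise XNOR, so (Div n, ⊞) is an elementary abelian 2-group with neutral
-- element N = (1,…,1), and a ⊞ 1 = a while a ⊞ 0 is the complement N/a. Complementation reverses
-- the order and a strictly increasing self-map of Fin 2ⁿ is the identity, so the sorted
-- enumeration satisfies d_{s+1-i} = N/d_i; likewise d₁ = 1, the least divisor. The sign of a is
-- (-1) to the number of zeros of a, whose parity is additive under ⊞. For (5), r(k) is d_k with
-- the exponent of p_ℓ flipped: as p_ℓ divides neither d_ij nor d_kj it divides d_ik, and the flip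
-- moves this factor p_ℓ from d_ik to d_kj.
module Submission where

open import Defs
open import Data.Bool using (Bool; true; false; not; _xor_)
import Data.Nat
open import Data.Nat using (ℕ; zero; suc; _^_; _*_; _∸_; _≤_; z≤n; s≤s; NonZero) renaming (_<_ to _<ℕ_)
open import Data.Nat.Divisibility using (_∣_; _∤_; ∣-trans; m∣m*n; n∣m*n; ∣1⇒≡1)
open import Data.Nat.Primality using (Prime; euclidsLemma; prime⇒irreducible; prime⇒nonZero; ¬prime[1])
open import Data.Nat.DivMod using (m*n/n≡m)
import Data.Nat.Properties as ℕ
open import Algebra.Properties.CommutativeSemigroup ℕ.*-commutativeSemigroup using (x∙yz≈y∙xz; xy∙z≈y∙xz)
open import Data.Fin using (Fin; zero; suc; toℕ; opposite; _<_; inject₁)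
open import Data.Fin.Properties using (<-cmp; toℕ-injective; toℕ<n; toℕ-inject₁; toℕ-↑ˡ; opposite-prop; opposite-involutive)
open import Data.Vec using (Vec; []; _∷_; lookup; map; replicate; zipWith; tabulate; updateAt)
open import Data.Vec.Properties using (zipWith-comm; zipWith-assoc; zipWith-replicate₂; lookup-zipWith; lookup∘updateAt; tabulate∘lookup; tabulate-cong; map-cong)
open import Data.Vec.Relation.Unary.All using (All; []; _∷_)
open import Data.Vec.Relation.Unary.All.Properties using (lookup⁺)
open import Data.Integer using (ℤ; -1ℤ) renaming (_*_ to _*ℤ_; _^_ to _^ℤ_)
open import Data.Integer.Tactic.RingSolver using (solve-∀)
open import Data.Product using (_×_; Σ; ∃; _,_; proj₁; proj₂)
open import Data.Sum using (inj₁; inj₂)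
open import Data.Empty using (⊥-elim)
open import Function using (_∘_)
open import Function.Definitions using (Injective)
open import Relation.Nullary using (¬_)
open import Relation.Binary using (Rel; Transitive; tri<; tri≈; tri>)
open import Relation.Binary.PropositionalEquality using (_≡_; _≢_; refl; sym; trans; cong; cong₂; subst; subst₂; module ≡-Reasoning)

_⊞ᵇ_ : Bool → Bool → Bool
x ⊞ᵇ y = not (x xor y)

⊞ᵇ-comm : ∀ x y → x ⊞ᵇ y ≡ y ⊞ᵇ x
⊞ᵇ-comm true  true  = refl
⊞ᵇ-comm true  false = refl
⊞ᵇ-comm false true  = refl
⊞ᵇ-comm false false = refl

⊞ᵇ-assoc : ∀ x y z → (x ⊞ᵇ y) ⊞ᵇ z ≡ x ⊞ᵇ (y ⊞ᵇ z)
⊞ᵇ-assoc true  true  true  = refl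
⊞ᵇ-assoc true  true  false = refl
⊞ᵇ-assoc true  false true  = refl
⊞ᵇ-assoc true  false false = refl
⊞ᵇ-assoc false true  true  = refl
⊞ᵇ-assoc false true  false = refl
⊞ᵇ-assoc false false true  = refl
⊞ᵇ-assoc false false false = refl

⊞ᵇ-identityʳ : ∀ x → x ⊞ᵇ true ≡ x
⊞ᵇ-identityʳ true  = refl
⊞ᵇ-identityʳ false = refl

⊞ᵇ-self : ∀ x → x ⊞ᵇ x ≡ true
⊞ᵇ-self true  = refl
⊞ᵇ-self false = refl

⊞ᵇ-false : ∀ x → x ⊞ᵇ false ≡ not x
⊞ᵇ-false true  = refl
⊞ᵇ-false false = refl

not-⊞ᵇ-not : ∀ x y → not x ⊞ᵇ not y ≡ x ⊞ᵇ y
not-⊞ᵇ-not true  true  = refl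
not-⊞ᵇ-not true  false = refl
not-⊞ᵇ-not false true  = refl
not-⊞ᵇ-not false false = refl

not-⊞ᵇ : ∀ x y → not x ⊞ᵇ y ≡ not (x ⊞ᵇ y)
not-⊞ᵇ true  true  = refl
not-⊞ᵇ true  false = refl
not-⊞ᵇ false true  = refl
not-⊞ᵇ false false = refl

⊞-comm : ∀ {n} (a b : Div n) → a ⊞ b ≡ b ⊞ a
⊞-comm = zipWith-comm ⊞ᵇ-comm

⊞-assoc : ∀ {n} (a b c : Div n) → (a ⊞ b) ⊞ c ≡ a ⊞ (b ⊞ c)
⊞-assoc = zipWith-assoc ⊞ᵇ-assoc

⊞-identityʳ : ∀ {n} (a : Div n) → a ⊞ replicate n true ≡ a
⊞-identityʳ []      = refl
⊞-identityʳ (x ∷ a) = cong₂ _∷_ (⊞ᵇ-identityʳ x) (⊞-identityʳ a)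

⊞-self : ∀ {n} (a : Div n) → a ⊞ a ≡ replicate n true
⊞-self []      = refl
⊞-self (x ∷ a) = cong₂ _∷_ (⊞ᵇ-self x) (⊞-self a)

a⊞[a⊞b]≡b : ∀ {n} (a b : Div n) → a ⊞ (a ⊞ b) ≡ b
a⊞[a⊞b]≡b {n} a b = begin
  a ⊞ (a ⊞ b)             ≡⟨ ⊞-assoc a a b ⟨
  (a ⊞ a) ⊞ b             ≡⟨ cong (_⊞ b) (⊞-self a) ⟩
  replicate n true ⊞ b    ≡⟨ ⊞-comm _ b ⟩
  b ⊞ replicate n true    ≡⟨ ⊞-identityʳ b ⟩
  b                       ∎
  where open ≡-Reasoning

[a⊞b]⊞b≡a : ∀ {n} (a b : Div n) → (a ⊞ b) ⊞ b ≡ a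
[a⊞b]⊞b≡a a b = trans (⊞-comm (a ⊞ b) b) (trans (cong (b ⊞_) (⊞-comm a b)) (a⊞[a⊞b]≡b b a))

⊞-cancelʳ-≡ : ∀ {n} (a b c : Div n) → a ⊞ c ≡ b ⊞ c → a ≡ b
⊞-cancelʳ-≡ a b c eq = begin
  a            ≡⟨ [a⊞b]⊞b≡a a c ⟨
  (a ⊞ c) ⊞ c  ≡⟨ cong (_⊞ c) eq ⟩
  (b ⊞ c) ⊞ c  ≡⟨ [a⊞b]⊞b≡a b c ⟩
  b            ∎
  where open ≡-Reasoning

[a⊞c]⊞[b⊞c]≡a⊞b : ∀ {n} (a b c : Div n) → (a ⊞ c) ⊞ (b ⊞ c) ≡ a ⊞ b
[a⊞c]⊞[b⊞c]≡a⊞b a b c = begin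
  (a ⊞ c) ⊞ (b ⊞ c)  ≡⟨ cong ((a ⊞ c) ⊞_) (⊞-comm b c) ⟩
  (a ⊞ c) ⊞ (c ⊞ b)  ≡⟨ ⊞-assoc a c (c ⊞ b) ⟩
  a ⊞ (c ⊞ (c ⊞ b))  ≡⟨ cong (a ⊞_) (a⊞[a⊞b]≡b c b) ⟩
  a ⊞ b              ∎
  where open ≡-Reasoning

comp : ∀ {n} → Div n → Div n
comp = map not

a⊞0≡comp : ∀ {n} (a : Div n) → a ⊞ replicate n false ≡ comp a
a⊞0≡comp a = trans (zipWith-replicate₂ _⊞ᵇ_ a false) (map-cong ⊞ᵇ-false a)

comp-⊞-comp : ∀ {n} (a b : Div n) → comp a ⊞ comp b ≡ a ⊞ b
comp-⊞-comp []      []      = refl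
comp-⊞-comp (x ∷ a) (y ∷ b) = cong₂ _∷_ (not-⊞ᵇ-not x y) (comp-⊞-comp a b)

toggle : ∀ {n} → Fin n → Div n → Div n
toggle ℓ a = updateAt a ℓ not

toggle-involutive : ∀ {n} (ℓ : Fin n) (a : Div n) → toggle ℓ (toggle ℓ a) ≡ a
toggle-involutive zero    (true  ∷ a) = refl
toggle-involutive zero    (false ∷ a) = refl
toggle-involutive (suc ℓ) (x ∷ a)     = cong (x ∷_) (toggle-involutive ℓ a)

toggle-⊞ : ∀ {n} (ℓ : Fin n) (a b : Div n) → toggle ℓ a ⊞ b ≡ toggle ℓ (a ⊞ b)
toggle-⊞ zero    (x ∷ a) (y ∷ b) = cong (_∷ zipWith _⊞ᵇ_ a b) (not-⊞ᵇ x y)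
toggle-⊞ (suc ℓ) (x ∷ a) (y ∷ b) = cong (x ⊞ᵇ y ∷_) (toggle-⊞ ℓ a b)

ω≤n : ∀ {n} (a : Div n) → ω a ≤ n
ω≤n []          = z≤n
ω≤n (true  ∷ a) = s≤s (ω≤n a)
ω≤n (false ∷ a) = ℕ.m≤n⇒m≤1+n (ω≤n a)

ω-comp : ∀ {n} (a : Div n) → ω (comp a) ≡ n ∸ ω a
ω-comp []          = refl
ω-comp (true  ∷ a) = ω-comp a
ω-comp (false ∷ a) = trans (cong suc (ω-comp a)) (sym (ℕ.+-∸-assoc 1 (ω≤n a)))

≺lex-irrefl : ∀ {n} (a : Div n) → ¬ a ≺lex a
≺lex-irrefl (x ∷ a) (there a≺a) = ≺lex-irrefl a a≺a

≺lex-trans : ∀ {n} → Transitive (_≺lex_ {n})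
≺lex-trans here       (there _)  = here
≺lex-trans (there _)  here       = here
≺lex-trans (there ab) (there bc) = there (≺lex-trans ab bc)

≺lex-comp : ∀ {n} {a b : Div n} → a ≺lex b → comp b ≺lex comp a
≺lex-comp here       = here
≺lex-comp (there ab) = there (≺lex-comp ab)

<S-irrefl : ∀ {n} (a : Div n) → ¬ a <S a
<S-irrefl a (inj₁ ωa<ωa)      = ℕ.<-irrefl refl ωa<ωa
<S-irrefl a (inj₂ (_ , a≺a)) = ≺lex-irrefl a a≺a

<S-trans : ∀ {n} → Transitive (_<S_ {n})
<S-trans (inj₁ ab)        (inj₁ bc)        = inj₁ (ℕ.<-trans ab bc)
<S-trans (inj₁ ab)        (inj₂ (bc , _))  = inj₁ (subst (_ <ℕ_) bc ab)
<S-trans (inj₂ (ab , _))  (inj₁ bc)        = inj₁ (subst (_<ℕ _) (sym ab) bc)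
<S-trans (inj₂ (ab , l))  (inj₂ (bc , m))  = inj₂ (trans ab bc , ≺lex-trans l m)

<S-comp : ∀ {n} {a b : Div n} → a <S b → comp b <S comp a
<S-comp {n} {a} {b} (inj₁ ωa<ωb) = inj₁ (subst₂ _<ℕ_ (sym (ω-comp b)) (sym (ω-comp a)) (ℕ.∸-monoʳ-< ωa<ωb (ω≤n b)))
<S-comp {n} {a} {b} (inj₂ (ωa≡ωb , a≺b)) =
  inj₂ (trans (ω-comp b) (trans (cong (n ∸_) (sym ωa≡ωb)) (sym (ω-comp a))) , ≺lex-comp a≺b)

ω-0 : ∀ n → ω (replicate n false) ≡ 0
ω-0 zero    = refl
ω-0 (suc n) = ω-0 n

ω≡0⇒0 : ∀ {n} (a : Div n) → ω a ≡ 0 → a ≡ replicate n false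
ω≡0⇒0 []          _    = refl
ω≡0⇒0 (false ∷ a) ωa≡0 = cong (false ∷_) (ω≡0⇒0 a ωa≡0)

≮S-0 : ∀ {n} (a : Div n) → ¬ a <S replicate n false
≮S-0 {n} a (inj₁ ωa<ω0)       = ℕ.n≮0 (subst (ω a <ℕ_) (ω-0 n) ωa<ω0)
≮S-0 {n} a (inj₂ (ωa≡ω0 , a≺0)) =
  ≺lex-irrefl _ (subst (_≺lex replicate n false) (ω≡0⇒0 a (trans ωa≡ω0 (ω-0 n))) a≺0)

opposite-< : ∀ {m} {i j : Fin m} → i < j → opposite j < opposite i
opposite-< {i = i} {j} i<j =
  subst₂ _<ℕ_ (sym (opposite-prop j)) (sym (opposite-prop i)) (ℕ.∸-monoʳ-< (s≤s i<j) (toℕ<n j))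

module _ {m} (f : Fin m → Fin m) (f-mono : ∀ i j → i < j → f i < f j) where

  increasing⇒inflationary : ∀ i → toℕ i ≤ toℕ (f i)
  increasing⇒inflationary i = go (toℕ i) i refl
    where
    go : ∀ k i → toℕ i ≡ k → k ≤ toℕ (f i)
    go zero    _       _     = z≤n
    go (suc k) (suc i) i≡1+k =
      ℕ.≤-trans (s≤s (go k (inject₁ i) (trans (toℕ-inject₁ i) (ℕ.suc-injective i≡1+k))))
                (f-mono (inject₁ i) (suc i) (s≤s (ℕ.≤-reflexive (toℕ-inject₁ i))))

increasing⇒id : ∀ {m} (f : Fin m → Fin m) → (∀ i j → i < j → f i < f j) → ∀ i → f i ≡ i
increasing⇒id {m} f f-mono i =
  toℕ-injective (ℕ.≤-antisym (ℕ.≮⇒≥ i≮fi) (increasing⇒inflationary f f-mono i))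
  where
  -- The conjugate of f by opposite is increasing as well; its inflationarity makes f deflationary.
  f̃ : Fin m → Fin m
  f̃ j = opposite (f (opposite j))
  f̃-mono : ∀ j k → j < k → f̃ j < f̃ k
  f̃-mono j k j<k = opposite-< (f-mono _ _ (opposite-< j<k))
  i≮fi : ¬ i < f i
  i≮fi i<fi = ℕ.<⇒≱ (opposite-< i<fi)
    (subst (λ t → toℕ (opposite i) ≤ toℕ (opposite (f t))) (opposite-involutive i)
           (increasing⇒inflationary f̃ f̃-mono (opposite i)))

module SortedEnumeration {a r} {A : Set a} {_≺_ : Rel A r}
  (≺-irrefl : ∀ x → ¬ x ≺ x) (≺-trans : Transitive _≺_)
  {m} (d : Fin m → A) (d-mono : ∀ i j → i < j → d i ≺ d j) (d-surj : ∀ x → ∃ λ i → d i ≡ x)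
  where

  index : A → Fin m
  index x = proj₁ (d-surj x)

  d-index : ∀ x → d (index x) ≡ x
  d-index x = proj₂ (d-surj x)

  d-reflects : ∀ i j → d i ≺ d j → i < j
  d-reflects i j di≺dj with <-cmp i j
  ... | tri< i<j _ _  = i<j
  ... | tri≈ _ refl _ = ⊥-elim (≺-irrefl (d i) di≺dj)
  ... | tri> _ _ j<i  = ⊥-elim (≺-irrefl (d i) (≺-trans di≺dj (d-mono j i j<i)))

  d-injective : ∀ i j → d i ≡ d j → i ≡ j
  d-injective i j di≡dj with <-cmp i j
  ... | tri< i<j _ _ = ⊥-elim (≺-irrefl (d j) (subst (_≺ d j) di≡dj (d-mono i j i<j)))
  ... | tri≈ _ i≡j _ = i≡j
  ... | tri> _ _ j<i = ⊥-elim (≺-irrefl (d j) (subst (d j ≺_) di≡dj (d-mono j i j<i)))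

  d-opposite : (ρ : A → A) → (∀ {x y} → x ≺ y → ρ y ≺ ρ x) → ∀ i → d (opposite i) ≡ ρ (d i)
  d-opposite ρ ρ-anti i = begin
    d (opposite i)       ≡⟨ cong (d ∘ opposite) (σ-id i) ⟨
    d (opposite (σ i))   ≡⟨ cong d (opposite-involutive _) ⟩
    d (index (ρ (d i)))  ≡⟨ d-index (ρ (d i)) ⟩
    ρ (d i)              ∎
    where
    open ≡-Reasoning
    σ : Fin m → Fin m
    σ j = opposite (index (ρ (d j)))
    σ-mono : ∀ j k → j < k → σ j < σ k
    σ-mono j k j<k = opposite-< (d-reflects _ _
      (subst₂ _≺_ (sym (d-index _)) (sym (d-index _)) (ρ-anti (d-mono j k j<k))))
    σ-id : ∀ j → σ j ≡ j
    σ-id = increasing⇒id σ σ-mono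

  d-least : (x₀ : A) → (∀ x → ¬ x ≺ x₀) → ∀ i → toℕ i ≡ 0 → d i ≡ x₀
  d-least x₀ x₀-least i i≡0 with <-cmp i (index x₀)
  ... | tri< i<j _ _  = ⊥-elim (x₀-least (d i) (subst (d i ≺_) (d-index x₀) (d-mono _ _ i<j)))
  ... | tri≈ _ refl _ = d-index x₀
  ... | tri> _ _ j<i  = ⊥-elim (ℕ.n≮0 (subst (toℕ (index x₀) <ℕ_) i≡0 j<i))

val-comp : ∀ {n} (p : Vec ℕ n) (a : Div n) → val p (comp a) * val p a ≡ prodN p
val-comp []       []          = refl
val-comp (q ∷ ps) (true  ∷ a) = trans (x∙yz≈y∙xz (val ps (comp a)) q (val ps a)) (cong (q *_) (val-comp ps a))
val-comp (q ∷ ps) (false ∷ a) = trans (ℕ.*-assoc q (val ps (comp a)) (val ps a)) (cong (q *_) (val-comp ps a))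

val-nonZero : ∀ {n} {p : Vec ℕ n} → All Prime p → (a : Div n) → NonZero (val p a)
val-nonZero []             []          = _
val-nonZero (q-prime ∷ ps) (true  ∷ a) = ℕ.m*n≢0 _ _ {{prime⇒nonZero q-prime}} {{val-nonZero ps a}}
val-nonZero (q-prime ∷ ps) (false ∷ a) = val-nonZero ps a

m*n-div-n : ∀ m n → .{{NonZero n}} → (m * n) div n ≡ m
m*n-div-n m (suc k) = m*n/n≡m m (suc k)

prodN-div-val : ∀ {n} {p : Vec ℕ n} → All Prime p → (a : Div n) → prodN p div val p a ≡ val p (comp a)
prodN-div-val {p = p} p-prime a = begin
  prodN p div val p a                      ≡⟨ cong (_div val p a) (val-comp p a) ⟨
  (val p (comp a) * val p a) div val p a   ≡⟨ m*n-div-n (val p (comp a)) (val p a) {{val-nonZero p-prime a}} ⟩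
  val p (comp a)                           ∎
  where open ≡-Reasoning

bit⇒∣val : ∀ {n} (p : Vec ℕ n) (a : Div n) (ℓ : Fin n) → lookup a ℓ ≡ true → lookup p ℓ ∣ val p a
bit⇒∣val (q ∷ ps) (true  ∷ a) zero    _  = m∣m*n (val ps a)
bit⇒∣val (q ∷ ps) (true  ∷ a) (suc ℓ) aℓ = ∣-trans (bit⇒∣val ps a ℓ aℓ) (n∣m*n q)
bit⇒∣val (q ∷ ps) (false ∷ a) (suc ℓ) aℓ = bit⇒∣val ps a ℓ aℓ

∤val⇒bit-false : ∀ {n} (p : Vec ℕ n) (a : Div n) (ℓ : Fin n) → lookup p ℓ ∤ val p a → lookup a ℓ ≡ false
∤val⇒bit-false p a ℓ pℓ∤a with lookup a ℓ in aℓ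
... | true  = ⊥-elim (pℓ∤a (bit⇒∣val p a ℓ aℓ))
... | false = refl

prime∣val⇒selected : ∀ {n q} {p : Vec ℕ n} → Prime q → All Prime p → (a : Div n) → q ∣ val p a
                   → ∃ λ ℓ → lookup a ℓ ≡ true × q ≡ lookup p ℓ
prime∣val⇒selected q-prime [] [] q∣1 = ⊥-elim (¬prime[1] (subst Prime (∣1⇒≡1 q∣1) q-prime))
prime∣val⇒selected {p = p₀ ∷ ps} q-prime (p₀-prime ∷ ps-prime) (true ∷ a) q∣p₀*a
  with euclidsLemma p₀ (val ps a) q-prime q∣p₀*a
... | inj₂ q∣a = let ℓ , aℓ , q≡pℓ = prime∣val⇒selected q-prime ps-prime a q∣a in suc ℓ , aℓ , q≡pℓ
... | inj₁ q∣p₀ with prime⇒irreducible p₀-prime q∣p₀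
...   | inj₁ q≡1  = ⊥-elim (¬prime[1] (subst Prime q≡1 q-prime))
...   | inj₂ q≡p₀ = zero , refl , q≡p₀
prime∣val⇒selected q-prime (_ ∷ ps-prime) (false ∷ a) q∣a =
  let ℓ , aℓ , q≡pℓ = prime∣val⇒selected q-prime ps-prime a q∣a in suc ℓ , aℓ , q≡pℓ

∣val⇒bit : ∀ {n} {p : Vec ℕ n} → All Prime p → Injective _≡_ _≡_ (lookup p)
         → (a : Div n) (ℓ : Fin n) → lookup p ℓ ∣ val p a → lookup a ℓ ≡ true
∣val⇒bit {p = p} p-prime p-injective a ℓ pℓ∣a
  with ℓ′ , aℓ′ , pℓ≡pℓ′ ← prime∣val⇒selected (lookup⁺ p-prime ℓ) p-prime a pℓ∣a
  rewrite p-injective pℓ≡pℓ′ = aℓ′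

val-injective : ∀ {n} {p : Vec ℕ n} → All Prime p → Injective _≡_ _≡_ (lookup p)
              → (a b : Div n) → val p a ≡ val p b → a ≡ b
val-injective {p = p} p-prime p-injective a b va≡vb = begin
  a                    ≡⟨ tabulate∘lookup a ⟨
  tabulate (lookup a)  ≡⟨ tabulate-cong same-bits ⟩
  tabulate (lookup b)  ≡⟨ tabulate∘lookup b ⟩
  b                    ∎
  where
  open ≡-Reasoning
  bit-transfer : ∀ {x y} ℓ → val p x ≡ val p y → lookup x ℓ ≡ true → lookup y ℓ ≡ true
  bit-transfer {x} {y} ℓ vx≡vy xℓ = ∣val⇒bit p-prime p-injective y ℓ (subst (lookup p ℓ ∣_) vx≡vy (bit⇒∣val p x ℓ xℓ))
  same-bits : ∀ ℓ → lookup a ℓ ≡ lookup b ℓ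
  same-bits ℓ with lookup a ℓ in aℓ | lookup b ℓ in bℓ
  ... | true  | true  = refl
  ... | false | false = refl
  ... | true  | false = trans (sym (bit-transfer ℓ va≡vb aℓ)) bℓ
  ... | false | true  = trans (sym aℓ) (bit-transfer ℓ (sym va≡vb) bℓ)

val-toggle : ∀ {n} (p : Vec ℕ n) (a : Div n) (ℓ : Fin n) → lookup a ℓ ≡ false
           → val p (toggle ℓ a) ≡ lookup p ℓ * val p a
val-toggle (q ∷ ps) (false ∷ a) zero    _  = refl
val-toggle (q ∷ ps) (true  ∷ a) (suc ℓ) aℓ =
  trans (cong (q *_) (val-toggle ps a ℓ aℓ)) (x∙yz≈y∙xz q (lookup ps ℓ) (val ps a))
val-toggle (q ∷ ps) (false ∷ a) (suc ℓ) aℓ = val-toggle ps a ℓ aℓ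

⊞-toggle : ∀ {n} (ℓ : Fin n) (a b : Div n) → a ⊞ toggle ℓ b ≡ toggle ℓ (a ⊞ b)
⊞-toggle ℓ a b = trans (⊞-comm a (toggle ℓ b)) (trans (toggle-⊞ ℓ b a) (cong (toggle ℓ) (⊞-comm b a)))

val-toggle-⊞ : ∀ {n} (p : Vec ℕ n) (a c : Div n) (ℓ : Fin n) → lookup (a ⊞ c) ℓ ≡ false
             → val p (toggle ℓ a ⊞ c) ≡ lookup p ℓ * val p (a ⊞ c)
val-toggle-⊞ p a c ℓ [a⊞c]ℓ = trans (cong (val p) (toggle-⊞ ℓ a c)) (val-toggle p (a ⊞ c) ℓ [a⊞c]ℓ)

val-⊞-exchange : ∀ {n} (p : Vec ℕ n) (a b c : Div n) (ℓ : Fin n)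
               → lookup (a ⊞ c) ℓ ≡ false → lookup (b ⊞ c) ℓ ≡ false
               → val p (a ⊞ b) * val p (b ⊞ c) ≡ val p (a ⊞ toggle ℓ b) * val p (toggle ℓ b ⊞ c)
val-⊞-exchange {n} p a b c ℓ [a⊞c]ℓ [b⊞c]ℓ = begin
  val p w * val p (b ⊞ c)
    ≡⟨ cong (λ x → val p x * val p (b ⊞ c)) (toggle-involutive ℓ w) ⟨
  val p (toggle ℓ (toggle ℓ w)) * val p (b ⊞ c)
    ≡⟨ cong (_* val p (b ⊞ c)) (val-toggle p (toggle ℓ w) ℓ [toggle-w]ℓ) ⟩
  lookup p ℓ * val p (toggle ℓ w) * val p (b ⊞ c)
    ≡⟨ xy∙z≈y∙xz (lookup p ℓ) (val p (toggle ℓ w)) (val p (b ⊞ c)) ⟩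
  val p (toggle ℓ w) * (lookup p ℓ * val p (b ⊞ c))
    ≡⟨ cong₂ (λ x y → val p x * y) (⊞-toggle ℓ a b) (val-toggle-⊞ p b c ℓ [b⊞c]ℓ) ⟨
  val p (a ⊞ toggle ℓ b) * val p (toggle ℓ b ⊞ c)
    ∎
  where
  open ≡-Reasoning
  w : Div n
  w = a ⊞ b
  wℓ : lookup w ℓ ≡ true
  wℓ = begin
    lookup (a ⊞ b) ℓ                      ≡⟨ cong (λ x → lookup x ℓ) ([a⊞c]⊞[b⊞c]≡a⊞b a b c) ⟨
    lookup ((a ⊞ c) ⊞ (b ⊞ c)) ℓ          ≡⟨ lookup-zipWith _⊞ᵇ_ ℓ (a ⊞ c) (b ⊞ c) ⟩
    lookup (a ⊞ c) ℓ ⊞ᵇ lookup (b ⊞ c) ℓ  ≡⟨ cong₂ _⊞ᵇ_ [a⊞c]ℓ [b⊞c]ℓ ⟩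
    true                                  ∎
  [toggle-w]ℓ : lookup (toggle ℓ w) ℓ ≡ false
  [toggle-w]ℓ = trans (lookup∘updateAt ℓ w) (cong not wℓ)

-1*[x*y]≡x*[-1*y] : ∀ x y → -1ℤ *ℤ (x *ℤ y) ≡ x *ℤ (-1ℤ *ℤ y)
-1*[x*y]≡x*[-1*y] = solve-∀

-1*[x*y]≡[-1*x]*y : ∀ x y → -1ℤ *ℤ (x *ℤ y) ≡ (-1ℤ *ℤ x) *ℤ y
-1*[x*y]≡[-1*x]*y = solve-∀

x*y≡[-1*x]*[-1*y] : ∀ x y → x *ℤ y ≡ (-1ℤ *ℤ x) *ℤ (-1ℤ *ℤ y)
x*y≡[-1*x]*[-1*y] = solve-∀

-1^zeros : ∀ {n} → Div n → ℤ
-1^zeros a = -1ℤ ^ℤ ω (comp a)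

-1^zeros-⊞ : ∀ {n} (a b : Div n) → -1^zeros (a ⊞ b) ≡ -1^zeros a *ℤ -1^zeros b
-1^zeros-⊞ []          []          = refl
-1^zeros-⊞ (true  ∷ a) (true  ∷ b) = -1^zeros-⊞ a b
-1^zeros-⊞ (true  ∷ a) (false ∷ b) =
  trans (cong (-1ℤ *ℤ_) (-1^zeros-⊞ a b)) (-1*[x*y]≡x*[-1*y] (-1^zeros a) (-1^zeros b))
-1^zeros-⊞ (false ∷ a) (true  ∷ b) =
  trans (cong (-1ℤ *ℤ_) (-1^zeros-⊞ a b)) (-1*[x*y]≡[-1*x]*y (-1^zeros a) (-1^zeros b))
-1^zeros-⊞ (false ∷ a) (false ∷ b) =
  trans (-1^zeros-⊞ a b) (x*y≡[-1*x]*[-1*y] (-1^zeros a) (-1^zeros b))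

sgn≡-1^zeros : ∀ {n} (a : Div n) → sgn a ≡ -1^zeros a
sgn≡-1^zeros a = cong (-1ℤ ^ℤ_) (sym (ω-comp a))

sgn-⊞ : ∀ {n} (a b : Div n) → sgn (a ⊞ b) ≡ sgn a *ℤ sgn b
sgn-⊞ a b = begin
  sgn (a ⊞ b)                ≡⟨ sgn≡-1^zeros (a ⊞ b) ⟩
  -1^zeros (a ⊞ b)           ≡⟨ -1^zeros-⊞ a b ⟩
  -1^zeros a *ℤ -1^zeros b   ≡⟨ cong₂ _*ℤ_ (sgn≡-1^zeros a) (sgn≡-1^zeros b) ⟨
  sgn a *ℤ sgn b             ∎
  where open ≡-Reasoning

toℕ-first : ∀ n → toℕ (first n) ≡ 0
toℕ-first zero    = refl
toℕ-first (suc n) = trans (toℕ-↑ˡ (first n) _) (toℕ-first n)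

module DivisorEnumeration {n} {p : Vec ℕ n} (p-prime : All Prime p) (p-injective : Injective _≡_ _≡_ (lookup p))
  (d : Fin (2 ^ n) → Div n) (d-mono : ∀ i j → i < j → d i <S d j) (d-surj : ∀ a → ∃ λ i → d i ≡ a)
  where

  open SortedEnumeration {_≺_ = _<S_} <S-irrefl <S-trans d d-mono d-surj

  d-opposite-comp : ∀ i → d (opposite i) ≡ comp (d i)
  d-opposite-comp = d-opposite comp <S-comp

  d-⊞-opposite : ∀ i j → d i ⊞ d j ≡ d (opposite i) ⊞ d (opposite j)
  d-⊞-opposite i j =
    sym (trans (cong₂ _⊞_ (d-opposite-comp i) (d-opposite-comp j)) (comp-⊞-comp (d i) (d j)))

  d-⊞-first-comp : ∀ i → d i ⊞ d (first n) ≡ comp (d i)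
  d-⊞-first-comp i =
    trans (cong (d i ⊞_) (d-least (replicate n false) ≮S-0 (first n) (toℕ-first n))) (a⊞0≡comp (d i))

  d-⊞-first : ∀ i → d i ⊞ d (first n) ≡ d (opposite i)
  d-⊞-first i = trans (d-⊞-first-comp i) (sym (d-opposite-comp i))

  val-d-⊞-first : ∀ i → val p (d i ⊞ d (first n)) ≡ prodN p div val p (d i)
  val-d-⊞-first i = trans (cong (val p) (d-⊞-first-comp i)) (sym (prodN-div-val p-prime (d i)))

  d-⊞-surjective : ∀ i a → ∃ λ k → d i ⊞ d k ≡ a
  d-⊞-surjective i a = index (d i ⊞ a) , trans (cong (d i ⊞_) (d-index (d i ⊞ a))) (a⊞[a⊞b]≡b (d i) a)

  d-⊞-exchange : ∀ ℓ i j → lookup p ℓ ∤ val p (d i ⊞ d j) → ∀ k → lookup p ℓ ∤ val p (d k ⊞ d j)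
               → Σ (Fin (2 ^ n)) λ r →
                   (val p (d r ⊞ d j) ≡ lookup p ℓ * val p (d k ⊞ d j))
                   × (∀ r′ → val p (d r′ ⊞ d j) ≡ lookup p ℓ * val p (d k ⊞ d j) → r′ ≡ r)
                   × (val p (d i ⊞ d k) * val p (d k ⊞ d j) ≡ val p (d i ⊞ d r) * val p (d r ⊞ d j))
  d-⊞-exchange ℓ i j pℓ∤dij k pℓ∤dkj = r , val-dr⊞dj , r-unique , exchange
    where
    r : Fin (2 ^ n)
    r = index (toggle ℓ (d k))
    dr≡toggle : d r ≡ toggle ℓ (d k)
    dr≡toggle = d-index (toggle ℓ (d k))
    [dk⊞dj]ℓ : lookup (d k ⊞ d j) ℓ ≡ false
    [dk⊞dj]ℓ = ∤val⇒bit-false p (d k ⊞ d j) ℓ pℓ∤dkj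
    val-dr⊞dj : val p (d r ⊞ d j) ≡ lookup p ℓ * val p (d k ⊞ d j)
    val-dr⊞dj = trans (cong (λ x → val p (x ⊞ d j)) dr≡toggle) (val-toggle-⊞ p (d k) (d j) ℓ [dk⊞dj]ℓ)
    r-unique : ∀ r′ → val p (d r′ ⊞ d j) ≡ lookup p ℓ * val p (d k ⊞ d j) → r′ ≡ r
    r-unique r′ val-dr′⊞dj = d-injective r′ r
      (⊞-cancelʳ-≡ (d r′) (d r) (d j) (val-injective p-prime p-injective _ _ (trans val-dr′⊞dj (sym val-dr⊞dj))))
    exchange : val p (d i ⊞ d k) * val p (d k ⊞ d j) ≡ val p (d i ⊞ d r) * val p (d r ⊞ d j)
    exchange = subst (λ x → val p (d i ⊞ d k) * val p (d k ⊞ d j) ≡ val p (d i ⊞ x) * val p (x ⊞ d j))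
      (sym dr≡toggle)
      (val-⊞-exchange p (d i) (d k) (d j) ℓ (∤val⇒bit-false p (d i ⊞ d j) ℓ pℓ∤dij) [dk⊞dj]ℓ)

lemma3p3 : (n : ℕ) (p : Vec ℕ n) → All Prime p
    → (∀ a b → lookup p a ≡ lookup p b → a ≡ b)
    → (d : Fin (2 ^ n) → Div n)
    → (∀ i j → i < j → d i <S d j)
    → (∀ a → ∃ λ i → d i ≡ a)
    → (∀ i j → (d i ⊞ d j ≡ d j ⊞ d i) × (d i ⊞ d j ≡ d (opposite i) ⊞ d (opposite j)))
      × (∀ i → (val p (d i ⊞ d (first n)) ≡ prodN p div val p (d i)) × (d i ⊞ d (first n) ≡ d (opposite i)))
      × (∀ i a → ∃ λ k → d i ⊞ d k ≡ a)
      × (∀ i j → sgn (d i ⊞ d j) ≡ sgn (d i) *ℤ sgn (d j))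
      × (∀ (ℓ : Fin n) → suc (toℕ ℓ) ≡ n → ∀ i j → i ≢ j
          → lookup p ℓ ∤ val p (d i ⊞ d j)
          → ∀ k → lookup p ℓ ∤ val p (d k ⊞ d j)
          → Σ (Fin (2 ^ n)) λ r →
              (val p (d r ⊞ d j) ≡ lookup p ℓ Data.Nat.* val p (d k ⊞ d j))
              × (∀ r′ → val p (d r′ ⊞ d j) ≡ lookup p ℓ Data.Nat.* val p (d k ⊞ d j) → r′ ≡ r)
              × (val p (d i ⊞ d k) Data.Nat.* val p (d k ⊞ d j)
                 ≡ val p (d i ⊞ d r) Data.Nat.* val p (d r ⊞ d j)))
lemma3p3 n p p-prime p-injective d d-mono d-surj =
    (λ i j → ⊞-comm (d i) (d j) , d-⊞-opposite i j)
  , (λ i → val-d-⊞-first i , d-⊞-first i)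
  , d-⊞-surjective
  , (λ i j → sgn-⊞ (d i) (d j))
  -- (5) holds for every prime index ℓ and all i, j: neither ℓ being the last index nor i ≢ j is needed.
  , (λ ℓ _ i j _ → d-⊞-exchange ℓ i j)
  where open DivisorEnumeration p-prime (λ {a} {b} → p-injective a b) d d-mono d-surj
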